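{- For all $n\ge 2$, $\overline{q}_n(132,312)=4\cdot 3^{n-2}$.
   Context: For a positive integer $n$, let $\mathcal{S}_{n,n}$ denote the set of all permutations (words) $\pi=\pi_1\cdots\pi_{2n}$ of the multiset $\{1,1,2,2,\ldots,n,n\}$. A word $\pi$ contains a pattern $\sigma=\sigma_1\cdots\sigma_k$ if there are indices $i_1<\cdots<i_k$ such that $\pi_{i_a}=\pi_{i_b}$ iff $\sigma_a=\sigma_b$ and $\pi_{i_a}<\pi_{i_b}$ iff $\sigma_a<\sigma_b$ for all $a,b$; otherwise $\pi$ avoids $\sigma$. The quasi-Stirling permutations $\overline{\mathcal{Q}}_n$ are the $\pi\in\mathcal{S}_{n,n}$ avoiding both $1212$ and $2121$. For a set $\Lambda$ of patterns, $\overline{\mathcal{Q}}_n(\Lambda)$ is the set of $\pi\in\overline{\mathcal{Q}}_n$ avoiding every pattern in $\Lambda$, and $\overline{q}_n(\Lambda)=|\overline{\mathcal{Q}}_n(\Lambda)|$. -}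

module Defs where

open import Data.Nat using (ℕ; zero; suc; _<ᵇ_; _≡ᵇ_)
open import Data.Bool using (Bool; true; false; _∧_; not; if_then_else_)
open import Data.List using (List; []; _∷_; map; concatMap; upTo; filter; length; zip)
open import Data.Bool.ListAction using (all; any)
open import Data.Bool.Properties using (T?)

wordsOver : ℕ → ℕ → List (List ℕ)
wordsOver n zero    = [] ∷ []
wordsOver n (suc k) = concatMap (λ x → map (x ∷_) (wordsOver n k)) (map suc (upTo n))

occ : ℕ → List ℕ → ℕ
occ a []      = 0
occ a (x ∷ w) = if a ≡ᵇ x then suc (occ a w) else occ a w

isSnn : ℕ → List ℕ → Bool
isSnn n w = all (λ a → occ a w ≡ᵇ 2) (map suc (upTo n))

Snn : ℕ → List (List ℕ)
Snn n = filter (λ w → T? (isSnn n w)) (wordsOver n (n Data.Nat.+ n))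

subseqs : ℕ → List ℕ → List (List ℕ)
subseqs zero    w       = [] ∷ []
subseqs (suc k) []      = []
subseqs (suc k) (x ∷ w) = map (x ∷_) (subseqs k w) Data.List.++ subseqs (suc k) w

sameLength : List ℕ → List ℕ → Bool
sameLength []      []      = true
sameLength (_ ∷ u) (_ ∷ v) = sameLength u v
sameLength _       _       = false

orderIso : List ℕ → List ℕ → Bool
orderIso u v =
  sameLength u v ∧
  all (λ p → all (λ q →
        ((Data.Product.proj₁ p ≡ᵇ Data.Product.proj₁ q) ≡ᵇᵇ (Data.Product.proj₂ p ≡ᵇ Data.Product.proj₂ q)) ∧
        ((Data.Product.proj₁ p <ᵇ Data.Product.proj₁ q) ≡ᵇᵇ (Data.Product.proj₂ p <ᵇ Data.Product.proj₂ q)))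
      (zip u v)) (zip u v)
  where
  import Data.Product
  _≡ᵇᵇ_ : Bool → Bool → Bool
  true  ≡ᵇᵇ b = b
  false ≡ᵇᵇ b = not b

contains : List ℕ → List ℕ → Bool
contains π σ = any (λ τ → orderIso τ σ) (subseqs (length σ) π)

avoids : List ℕ → List ℕ → Bool
avoids π σ = not (contains π σ)

avoidsAll : List (List ℕ) → List ℕ → Bool
avoidsAll Λ π = all (avoids π) Λ

isQuasiStirling : List ℕ → Bool
isQuasiStirling π = avoidsAll ((1 ∷ 2 ∷ 1 ∷ 2 ∷ []) ∷ (2 ∷ 1 ∷ 2 ∷ 1 ∷ []) ∷ []) π

Qbar : ℕ → List (List ℕ) → List (List ℕ)
Qbar n Λ = filter (λ π → T? (isQuasiStirling π ∧ avoidsAll Λ π)) (Snn n)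

qbar : ℕ → List (List ℕ) → ℕ
qbar n Λ = length (Qbar n Λ)

module Submission where

-- A word avoids 132 and 312 iff no letter lies strictly between the values of two earlier
-- letters, and it is quasi-Stirling iff no two distinct letters interleave as a b a b.  So once
-- both 1 and N have occurred only 1 and N can follow, and (for N ≥ 3, using a b a b once more)
-- a word of Q̄_N(132,312) ends in NN, 11, NN1 or 11N.  Deleting both copies of its second-to-last
-- letter, and lowering all letters by one if that letter was 1, gives a word of Q̄_{N-1}(132,312).
-- Conversely, for n ≥ 2, exactly three words reduce to a given w ∈ Q̄_n(132,312): w NN,
-- (w+1) 11 and, since w ends in 1 or n, the word obtained by inserting the pair of the other
-- extreme letter just before the last letter (of w, or of w+1 when inserting 11).  Hence
-- q̄_{n+1} = 3 q̄_n for n ≥ 2, and q̄_2 = 4 by computation.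

open import Data.Bool using (Bool; true; false; T; not; _∧_; if_then_else_)
open import Data.Bool.ListAction using (all)
open import Data.Bool.Properties using (T?; T-∧; T-≡)
open import Data.Empty using (⊥; ⊥-elim)
open import Data.List
  using (List; []; _∷_; _++_; [_]; initLast; _∷ʳ′_; take; reverse; map; length; zip; concatMap; upTo)
open import Data.List.Properties
  using ( ∷-injective; ∷-injectiveˡ; ∷-injectiveʳ; ++-assoc; ++-identityʳ; ++-cancelʳ; ++-conicalʳ
        ; length-++; length-map; map-++; map-injective; reverse-++)
open import Data.List.Membership.Propositional using (_∈_; _∉_; find; lose)
open import Data.List.Membership.Propositional.Properties
  using (∈-map⁺; ∈-map⁻; ∈-++⁺ˡ; ∈-++⁺ʳ; ∈-++⁻; ∈-concat⁺′; ∈-concat⁻′; ∈-upTo⁺; ∈-upTo⁻; ∈-filter⁺; ∈-filter⁻)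
open import Data.List.Membership.Propositional.Properties.WithK using (unique∧set⇒bag)
open import Data.List.Relation.Binary.BagAndSetEquality using (∼bag⇒↭)
open import Data.List.Relation.Binary.Disjoint.Propositional using (Disjoint)
open import Data.List.Relation.Binary.Permutation.Propositional.Properties using (↭-length)
open import Data.List.Relation.Binary.Sublist.Propositional
  using (_⊆_; []; _∷_; _∷ʳ_; ⊆-refl; ⊆-trans; minimum; from∈)
import Data.List.Relation.Binary.Sublist.Propositional.Properties as ⊆
open import Data.List.Relation.Unary.All as All using (All; []; _∷_)
import Data.List.Relation.Unary.All.Properties as All
open import Data.List.Relation.Unary.Any using (here; there)
open import Data.List.Relation.Unary.Any.Properties using (any⁺; any⁻)
open import Data.List.Relation.Unary.Unique.Propositional using (Unique; []; _∷_)
import Data.List.Relation.Unary.Unique.Propositional.Properties as Unique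
open import Data.Nat
open import Data.Nat.Properties
open import Algebra.Properties.CommutativeSemigroup *-commutativeSemigroup using (x∙yz≈y∙xz)
open import Data.Product using (_×_; _,_; proj₁; proj₂; ∃-syntax)
open import Data.Sum using (_⊎_; inj₁; inj₂)
import Data.Sum as Sum
open import Data.Unit using (⊤)
open import Function.Base using (_∘_)
open import Function.Bundles using (_⇔_; mk⇔; Equivalence)
open import Relation.Binary using (tri<; tri≈; tri>)
open import Relation.Binary.PropositionalEquality hiding ([_])
open import Relation.Nullary using (¬_; yes; no)

open import Defs

T-not⁺ : ∀ {b} → ¬ T b → T (not b)
T-not⁺ {false} _  = _
T-not⁺ {true}  ¬b = ¬b _

T-not⁻ : ∀ {b} → T (not b) → ¬ T b
T-not⁻ {false} _ ()

T-all-∈ : ∀ {A : Set} {p : A → Bool} {xs x} → T (all p xs) → x ∈ xs → T (p x)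
T-all-∈ {p = p} {xs} t = All.lookup (All.all⁺ p xs t)

T⇒≡true : ∀ {b} → T b → b ≡ true
T⇒≡true = Equivalence.to T-≡

¬T⇒≡false : ∀ {b} → ¬ T b → b ≡ false
¬T⇒≡false {false} _  = refl
¬T⇒≡false {true}  ¬b = ⊥-elim (¬b _)

≡ᵇ-refl : ∀ x → (x ≡ᵇ x) ≡ true
≡ᵇ-refl x = T⇒≡true (≡⇒≡ᵇ x x refl)

≡ᵇ≡true⇒≡ : ∀ {x y} → (x ≡ᵇ y) ≡ true → x ≡ y
≡ᵇ≡true⇒≡ eq = ≡ᵇ⇒≡ _ _ (Equivalence.from T-≡ eq)

≢⇒≡ᵇ≡false : ∀ {x y} → x ≢ y → (x ≡ᵇ y) ≡ false
≢⇒≡ᵇ≡false x≢y = ¬T⇒≡false (x≢y ∘ ≡ᵇ⇒≡ _ _)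

<ᵇ-irrefl : ∀ x → (x <ᵇ x) ≡ false
<ᵇ-irrefl x = ¬T⇒≡false (<-irrefl refl ∘ <ᵇ⇒< x x)

<⇒<ᵇ≡true : ∀ {x y} → x < y → (x <ᵇ y) ≡ true
<⇒<ᵇ≡true x<y = T⇒≡true (<⇒<ᵇ x<y)

<⇒>ᵇ≡false : ∀ {x y} → x < y → (y <ᵇ x) ≡ false
<⇒>ᵇ≡false x<y = ¬T⇒≡false (<-asym x<y ∘ <ᵇ⇒< _ _)

<⇒≡ᵇ≡false : ∀ {x y} → x < y → (x ≡ᵇ y) ≡ false
<⇒≡ᵇ≡false x<y = ≢⇒≡ᵇ≡false (<⇒≢ x<y)

>⇒≡ᵇ≡false : ∀ {x y} → x < y → (y ≡ᵇ x) ≡ false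
>⇒≡ᵇ≡false x<y = ≢⇒≡ᵇ≡false (>⇒≢ x<y)

pattern 1st = here refl
pattern 2nd = there 1st
pattern 3rd = there 2nd
pattern 4th = there 3rd

-- The comparison of booleans inside orderIso is local to its definition, so the agreement of
-- two positions is read off by splitting on all four comparisons; naming the first conjunct
-- of T-∧ is what lets `with` abstract them.
orderIso-agrees : ∀ u v → T (orderIso u v) → ∀ {x i y j} → (x , i) ∈ zip u v → (y , j) ∈ zip u v →
                  (x ≡ᵇ y) ≡ (i ≡ᵇ j) × (x <ᵇ y) ≡ (i <ᵇ j)
orderIso-agrees u v iso {x} {i} {y} {j} xi yj
  with x ≡ᵇ y | i ≡ᵇ j | x <ᵇ y | i <ᵇ j
     | T-all-∈ (T-all-∈ (proj₂ (Equivalence.to (T-∧ {sameLength u v}) iso)) xi) yj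
... | true  | true  | true  | true  | _ = refl , refl
... | true  | true  | false | false | _ = refl , refl
... | false | false | true  | true  | _ = refl , refl
... | false | false | false | false | _ = refl , refl
... | true  | false | _     | _     | ()
... | false | true  | _     | _     | ()
... | true  | true  | true  | false | ()
... | true  | true  | false | true  | ()
... | false | false | true  | false | ()
... | false | false | false | true  | ()

orderIso-< : ∀ u v → T (orderIso u v) → ∀ {x i y j} → (x , i) ∈ zip u v → (y , j) ∈ zip u v → T (i <ᵇ j) → x < y
orderIso-< u v iso xi yj i<j = <ᵇ⇒< _ _ (subst T (sym (proj₂ (orderIso-agrees u v iso xi yj))) i<j)

orderIso-≡ : ∀ u v → T (orderIso u v) → ∀ {x i y} → (x , i) ∈ zip u v → (y , i) ∈ zip u v → x ≡ y
orderIso-≡ u v iso {i = i} xi yi =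
  ≡ᵇ⇒≡ _ _ (subst T (sym (proj₁ (orderIso-agrees u v iso xi yi))) (≡⇒≡ᵇ i i refl))

orderIso-132 : ∀ {a b c} → a < c → c < b → T (orderIso (a ∷ b ∷ c ∷ []) (1 ∷ 3 ∷ 2 ∷ []))
orderIso-132 {a} {b} {c} a<c c<b
  rewrite ≡ᵇ-refl a | ≡ᵇ-refl b | ≡ᵇ-refl c | <ᵇ-irrefl a | <ᵇ-irrefl b | <ᵇ-irrefl c
        | <⇒<ᵇ≡true a<c | <⇒>ᵇ≡false a<c | <⇒≡ᵇ≡false a<c | >⇒≡ᵇ≡false a<c
        | <⇒<ᵇ≡true c<b | <⇒>ᵇ≡false c<b | <⇒≡ᵇ≡false c<b | >⇒≡ᵇ≡false c<b
        | <⇒<ᵇ≡true (<-trans a<c c<b) | <⇒>ᵇ≡false (<-trans a<c c<b)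
        | <⇒≡ᵇ≡false (<-trans a<c c<b) | >⇒≡ᵇ≡false (<-trans a<c c<b) = _

orderIso-312 : ∀ {a b c} → b < c → c < a → T (orderIso (a ∷ b ∷ c ∷ []) (3 ∷ 1 ∷ 2 ∷ []))
orderIso-312 {a} {b} {c} b<c c<a
  rewrite ≡ᵇ-refl a | ≡ᵇ-refl b | ≡ᵇ-refl c | <ᵇ-irrefl a | <ᵇ-irrefl b | <ᵇ-irrefl c
        | <⇒<ᵇ≡true b<c | <⇒>ᵇ≡false b<c | <⇒≡ᵇ≡false b<c | >⇒≡ᵇ≡false b<c
        | <⇒<ᵇ≡true c<a | <⇒>ᵇ≡false c<a | <⇒≡ᵇ≡false c<a | >⇒≡ᵇ≡false c<a
        | <⇒<ᵇ≡true (<-trans b<c c<a) | <⇒>ᵇ≡false (<-trans b<c c<a)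
        | <⇒≡ᵇ≡false (<-trans b<c c<a) | >⇒≡ᵇ≡false (<-trans b<c c<a) = _

orderIso-1212 : ∀ {a b} → a < b → T (orderIso (a ∷ b ∷ a ∷ b ∷ []) (1 ∷ 2 ∷ 1 ∷ 2 ∷ []))
orderIso-1212 {a} {b} a<b
  rewrite ≡ᵇ-refl a | ≡ᵇ-refl b | <ᵇ-irrefl a | <ᵇ-irrefl b
        | <⇒<ᵇ≡true a<b | <⇒>ᵇ≡false a<b | <⇒≡ᵇ≡false a<b | >⇒≡ᵇ≡false a<b = _

orderIso-2121 : ∀ {a b} → b < a → T (orderIso (a ∷ b ∷ a ∷ b ∷ []) (2 ∷ 1 ∷ 2 ∷ 1 ∷ []))
orderIso-2121 {a} {b} b<a
  rewrite ≡ᵇ-refl a | ≡ᵇ-refl b | <ᵇ-irrefl a | <ᵇ-irrefl b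
        | <⇒<ᵇ≡true b<a | <⇒>ᵇ≡false b<a | <⇒≡ᵇ≡false b<a | >⇒≡ᵇ≡false b<a = _

∈-subseqs⁻ : ∀ k π {τ} → τ ∈ subseqs k π → τ ⊆ π × length τ ≡ k
∈-subseqs⁻ zero    π       (here refl) = minimum π , refl
∈-subseqs⁻ (suc k) (x ∷ π) τ∈ with ∈-++⁻ (map (x ∷_) (subseqs k π)) τ∈
... | inj₂ τ∈′ = let τ⊆ , len = ∈-subseqs⁻ (suc k) π τ∈′ in x ∷ʳ τ⊆ , len
... | inj₁ τ∈′ with ∈-map⁻ (x ∷_) τ∈′
...   | τ′ , τ′∈ , refl = let τ⊆ , len = ∈-subseqs⁻ k π τ′∈ in refl ∷ τ⊆ , cong suc len

∈-subseqs⁺ : ∀ {τ π} → τ ⊆ π → τ ∈ subseqs (length τ) π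
∈-subseqs⁺ []                = here refl
∈-subseqs⁺ {[]}    (y ∷ʳ _)  = here refl
∈-subseqs⁺ {_ ∷ τ} (y ∷ʳ τ⊆) = ∈-++⁺ʳ (map (y ∷_) (subseqs (length τ) _)) (∈-subseqs⁺ τ⊆)
∈-subseqs⁺         (refl ∷ τ⊆) = ∈-++⁺ˡ (∈-map⁺ _ (∈-subseqs⁺ τ⊆))

contains⁻ : ∀ π σ → T (contains π σ) → ∃[ τ ] (τ ⊆ π × length τ ≡ length σ × T (orderIso τ σ))
contains⁻ π σ c with find (any⁻ _ _ c)
... | τ , τ∈ , iso = let τ⊆ , len = ∈-subseqs⁻ (length σ) π τ∈ in τ , τ⊆ , len , iso

contains⁺ : ∀ {π σ τ} → τ ⊆ π → length τ ≡ length σ → T (orderIso τ σ) → T (contains π σ)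
contains⁺ {π} {τ = τ} τ⊆ len iso = any⁺ _ (lose (subst (λ k → τ ∈ subseqs k π) len (∈-subseqs⁺ τ⊆)) iso)

Between : ℕ → ℕ → ℕ → Set
Between a c b = (a < c × c < b) ⊎ (b < c × c < a)

NoBetween : List ℕ → Set
NoBetween π = ∀ {a b c} → a ∷ b ∷ c ∷ [] ⊆ π → ¬ Between a c b

NoCrossing : List ℕ → Set
NoCrossing π = ∀ {a b} → a ∷ b ∷ a ∷ b ∷ [] ⊆ π → a ≡ b

avoids⁺ : ∀ {π} σ → (∀ {τ} → τ ⊆ π → length τ ≡ length σ → ¬ T (orderIso τ σ)) → T (avoids π σ)
avoids⁺ {π} σ free = T-not⁺ λ c → let τ , τ⊆ , len , iso = contains⁻ π σ c in free τ⊆ len iso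

avoids⁻ : ∀ {π σ τ} → T (avoids π σ) → τ ⊆ π → length τ ≡ length σ → ¬ T (orderIso τ σ)
avoids⁻ av τ⊆ len iso = T-not⁻ av (contains⁺ τ⊆ len iso)

Λ : List (List ℕ)
Λ = (1 ∷ 3 ∷ 2 ∷ []) ∷ (3 ∷ 1 ∷ 2 ∷ []) ∷ []

avoidsΛ⇔NoBetween : ∀ {π} → T (avoidsAll Λ π) ⇔ NoBetween π
avoidsΛ⇔NoBetween {π} = mk⇔ (to ∘ All.all⁺ (avoids π) Λ) from
  where
  to : All (T ∘ avoids π) Λ → NoBetween π
  to (av132 ∷ _ ∷ []) t (inj₁ (a<c , c<b)) = avoids⁻ av132 t refl (orderIso-132 a<c c<b)
  to (_ ∷ av312 ∷ []) t (inj₂ (b<c , c<a)) = avoids⁻ av312 t refl (orderIso-312 b<c c<a)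
  from : NoBetween π → T (avoidsAll Λ π)
  from nb = All.all⁻ (avoids π) {xs = Λ} (avoids⁺ (1 ∷ 3 ∷ 2 ∷ []) free132 ∷ avoids⁺ (3 ∷ 1 ∷ 2 ∷ []) free312 ∷ [])
    where
    free132 : ∀ {τ} → τ ⊆ π → length τ ≡ 3 → ¬ T (orderIso τ (1 ∷ 3 ∷ 2 ∷ []))
    free132 {τ@(_ ∷ _ ∷ _ ∷ [])} t refl iso =
      nb t (inj₁ (orderIso-< τ (1 ∷ 3 ∷ 2 ∷ []) iso 1st 3rd _ , orderIso-< τ (1 ∷ 3 ∷ 2 ∷ []) iso 3rd 2nd _))
    free312 : ∀ {τ} → τ ⊆ π → length τ ≡ 3 → ¬ T (orderIso τ (3 ∷ 1 ∷ 2 ∷ []))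
    free312 {τ@(_ ∷ _ ∷ _ ∷ [])} t refl iso =
      nb t (inj₂ (orderIso-< τ (3 ∷ 1 ∷ 2 ∷ []) iso 2nd 3rd _ , orderIso-< τ (3 ∷ 1 ∷ 2 ∷ []) iso 3rd 1st _))

crossings : List (List ℕ)
crossings = (1 ∷ 2 ∷ 1 ∷ 2 ∷ []) ∷ (2 ∷ 1 ∷ 2 ∷ 1 ∷ []) ∷ []

quasiStirling⇔NoCrossing : ∀ {π} → T (isQuasiStirling π) ⇔ NoCrossing π
quasiStirling⇔NoCrossing {π} = mk⇔ (to ∘ All.all⁺ (avoids π) crossings) from
  where
  to : All (T ∘ avoids π) crossings → NoCrossing π
  to (av1212 ∷ av2121 ∷ []) {a} {b} t with <-cmp a b
  ... | tri< a<b _ _ = ⊥-elim (avoids⁻ av1212 t refl (orderIso-1212 a<b))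
  ... | tri≈ _ a≡b _ = a≡b
  ... | tri> _ _ b<a = ⊥-elim (avoids⁻ av2121 t refl (orderIso-2121 b<a))
  from : NoCrossing π → T (isQuasiStirling π)
  from nc = All.all⁻ (avoids π) {xs = crossings}
                     (avoids⁺ (1 ∷ 2 ∷ 1 ∷ 2 ∷ []) free1212 ∷ avoids⁺ (2 ∷ 1 ∷ 2 ∷ 1 ∷ []) free2121 ∷ [])
    where
    free1212 : ∀ {τ} → τ ⊆ π → length τ ≡ 4 → ¬ T (orderIso τ (1 ∷ 2 ∷ 1 ∷ 2 ∷ []))
    free1212 {τ@(_ ∷ _ ∷ _ ∷ _ ∷ [])} t refl iso
      with orderIso-≡ τ (1 ∷ 2 ∷ 1 ∷ 2 ∷ []) iso 1st 3rd | orderIso-≡ τ (1 ∷ 2 ∷ 1 ∷ 2 ∷ []) iso 2nd 4th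
    ... | refl | refl = <-irrefl (nc t) (orderIso-< τ (1 ∷ 2 ∷ 1 ∷ 2 ∷ []) iso 1st 2nd _)
    free2121 : ∀ {τ} → τ ⊆ π → length τ ≡ 4 → ¬ T (orderIso τ (2 ∷ 1 ∷ 2 ∷ 1 ∷ []))
    free2121 {τ@(_ ∷ _ ∷ _ ∷ _ ∷ [])} t refl iso
      with orderIso-≡ τ (2 ∷ 1 ∷ 2 ∷ 1 ∷ []) iso 1st 3rd | orderIso-≡ τ (2 ∷ 1 ∷ 2 ∷ 1 ∷ []) iso 2nd 4th
    ... | refl | refl = <-irrefl (sym (nc t)) (orderIso-< τ (2 ∷ 1 ∷ 2 ∷ 1 ∷ []) iso 2nd 1st _)

Letter : ℕ → ℕ → Set
Letter n x = 1 ≤ x × x ≤ n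

record InSnn (n : ℕ) (π : List ℕ) : Set where
  field
    length≡ : length π ≡ n + n
    letters : All (Letter n) π
    twice   : ∀ {a} → Letter n a → occ a π ≡ 2

record InQbar (n : ℕ) (π : List ℕ) : Set where
  field
    inSnn      : InSnn n π
    noCrossing : NoCrossing π
    noBetween  : NoBetween π
  open InSnn inSnn public

∈-letters⁻ : ∀ {n a} → a ∈ map suc (upTo n) → Letter n a
∈-letters⁻ a∈ with ∈-map⁻ suc a∈
... | _ , i∈ , refl = s≤s z≤n , ∈-upTo⁻ i∈

∈-letters⁺ : ∀ {n a} → Letter n a → a ∈ map suc (upTo n)
∈-letters⁺ {a = suc i} (_ , a≤n) = ∈-map⁺ suc (∈-upTo⁺ a≤n)

∈-wordsOver⁻ : ∀ n k {π} → π ∈ wordsOver n k → length π ≡ k × All (Letter n) π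
∈-wordsOver⁻ n zero    (here refl) = refl , []
∈-wordsOver⁻ n (suc k) π∈ with ∈-concat⁻′ (map (λ x → map (x ∷_) (wordsOver n k)) (map suc (upTo n))) π∈
... | _ , π∈xs , xs∈ with ∈-map⁻ (λ x → map (x ∷_) (wordsOver n k)) xs∈
...   | a , a∈ , refl with ∈-map⁻ (a ∷_) π∈xs
...     | w , w∈ , refl = let len , ws = ∈-wordsOver⁻ n k w∈ in cong suc len , ∈-letters⁻ a∈ ∷ ws

∈-wordsOver⁺ : ∀ n {π} → All (Letter n) π → π ∈ wordsOver n (length π)
∈-wordsOver⁺ n []                    = here refl
∈-wordsOver⁺ n {a ∷ π} (a-ok ∷ π-ok) =
  ∈-concat⁺′ (∈-map⁺ (a ∷_) (∈-wordsOver⁺ n π-ok))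
             (∈-map⁺ (λ x → map (x ∷_) (wordsOver n (length π))) (∈-letters⁺ a-ok))

Unique-concatMap : ∀ {A B : Set} {P : A → Set} (f : A → List B) {xs} → Unique xs → All P xs →
  (∀ {x} → P x → Unique (f x)) → (∀ {x y} → P x → P y → x ≢ y → Disjoint (f x) (f y)) →
  Unique (concatMap f xs)
Unique-concatMap f {[]}     _          _          _     _        = []
Unique-concatMap f {x ∷ xs} (x∉ ∷ xs!) (px ∷ pxs) f-uniq f-disj =
  Unique.++⁺ (f-uniq px) (Unique-concatMap f xs! pxs f-uniq f-disj) disjoint
  where
  disjoint : Disjoint (f x) (concatMap f xs)
  disjoint (z∈fx , z∈rest) with ∈-concat⁻′ (map f xs) z∈rest
  ... | _ , z∈fy , fy∈ with ∈-map⁻ f fy∈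
  ...   | y , y∈ , refl = f-disj px (All.lookup pxs y∈) (All.lookup x∉ y∈) (z∈fx , z∈fy)

wordsOver-unique : ∀ n k → Unique (wordsOver n k)
wordsOver-unique n zero    = [] ∷ []
wordsOver-unique n (suc k) =
  Unique-concatMap {P = λ _ → ⊤} (λ x → map (x ∷_) (wordsOver n k))
    (Unique.map⁺ suc-injective (Unique.upTo⁺ n)) (All.universal _ _)
    (λ _ → Unique.map⁺ ∷-injectiveʳ (wordsOver-unique n k))
    (λ _ _ x≢y (z∈ , z∈′) → x≢y (heads-agree z∈ z∈′))
  where
  heads-agree : ∀ {x y z} → z ∈ map (x ∷_) (wordsOver n k) → z ∈ map (y ∷_) (wordsOver n k) → x ≡ y
  heads-agree z∈ z∈′ with ∈-map⁻ _ z∈ | ∈-map⁻ _ z∈′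
  ... | _ , _ , refl | _ , _ , eq = ∷-injectiveˡ eq

T-isSnn⇔ : ∀ {n π} → T (isSnn n π) ⇔ (∀ {a} → Letter n a → occ a π ≡ 2)
T-isSnn⇔ {n} {π} = mk⇔
  (λ t {_} a-ok → ≡ᵇ⇒≡ _ 2 (T-all-∈ t (∈-letters⁺ a-ok)))
  (λ tw → All.all⁻ _ (All.tabulate λ {a} a∈ → ≡⇒≡ᵇ (occ a π) 2 (tw (∈-letters⁻ a∈))))

∈-Qbar⇔ : ∀ {n π} → π ∈ Qbar n Λ ⇔ InQbar n π
∈-Qbar⇔ {n} {π} = mk⇔ to from
  where
  to : π ∈ Qbar n Λ → InQbar n π
  to π∈ with ∈-filter⁻ (λ π → T? (isQuasiStirling π ∧ avoidsAll Λ π)) {xs = Snn n} π∈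
  ... | π∈Snn , good with ∈-filter⁻ (λ w → T? (isSnn n w)) {xs = wordsOver n (n + n)} π∈Snn
  ...   | π∈words , snn =
    let len , ls = ∈-wordsOver⁻ n (n + n) π∈words
        qs , av  = Equivalence.to T-∧ good
    in record
      { inSnn      = record { length≡ = len ; letters = ls ; twice = Equivalence.to (T-isSnn⇔ {n} {π}) snn }
      ; noCrossing = Equivalence.to quasiStirling⇔NoCrossing qs
      ; noBetween  = Equivalence.to avoidsΛ⇔NoBetween av
      }
  from : InQbar n π → π ∈ Qbar n Λ
  from q = ∈-filter⁺ _ (∈-filter⁺ _ π∈words (Equivalence.from (T-isSnn⇔ {n} {π}) twice))
                       (Equivalence.from T-∧ ( Equivalence.from quasiStirling⇔NoCrossing noCrossing
                                             , Equivalence.from avoidsΛ⇔NoBetween noBetween))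
    where
    open InQbar q
    π∈words : π ∈ wordsOver n (n + n)
    π∈words = subst (λ k → π ∈ wordsOver n k) length≡ (∈-wordsOver⁺ n letters)

Qbar-unique : ∀ n → Unique (Qbar n Λ)
Qbar-unique n = Unique.filter⁺ _ (Unique.filter⁺ _ (wordsOver-unique n (n + n)))

++-cancel-prefix : ∀ (u u′ : List ℕ) {s s′} → length u ≡ length u′ → u ++ s ≡ u′ ++ s′ → u ≡ u′ × s ≡ s′
++-cancel-prefix []      []       _   eq = refl , eq
++-cancel-prefix (x ∷ u) (y ∷ u′) len eq with ∷-injective eq
... | refl , eq′ = let u≡u′ , s≡s′ = ++-cancel-prefix u u′ (suc-injective len) eq′ in cong (x ∷_) u≡u′ , s≡s′

++-injective : ∀ (u u′ : List ℕ) {s s′} → length s ≡ length s′ → u ++ s ≡ u′ ++ s′ → u ≡ u′ × s ≡ s′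
++-injective u u′ {s} {s′} len eq = ++-cancel-prefix u u′ (+-cancelʳ-≡ (length s′) _ _ lengths) eq
  where
  lengths : length u + length s′ ≡ length u′ + length s′
  lengths = begin
    length u + length s′  ≡⟨ cong (length u +_) (sym len) ⟩
    length u + length s   ≡⟨ sym (length-++ u) ⟩
    length (u ++ s)       ≡⟨ cong length eq ⟩
    length (u′ ++ s′)     ≡⟨ length-++ u′ ⟩
    length u′ + length s′ ∎
    where open ≡-Reasoning

∷ʳ-injective : ∀ (u u′ : List ℕ) {x x′} → u ++ [ x ] ≡ u′ ++ [ x′ ] → u ≡ u′ × x ≡ x′
∷ʳ-injective u u′ eq = let u≡u′ , xs≡ = ++-injective u u′ refl eq in u≡u′ , ∷-injectiveˡ xs≡

⊆-∷ʳ⁻ : ∀ {xs : List ℕ} {x y} u → xs ++ [ x ] ⊆ u ++ [ y ] → xs ++ [ x ] ⊆ u ⊎ (x ≡ y × xs ⊆ u)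
⊆-∷ʳ⁻ {[]}     []      (refl ∷ [])  = inj₂ (refl , [])
⊆-∷ʳ⁻ {_ ∷ xs} []      (refl ∷ t)   = ⊥-elim (nonempty⊈[] xs t)
  where
  nonempty⊈[] : ∀ xs {x} → ¬ (xs ++ [ x ] ⊆ [])
  nonempty⊈[] []      ()
  nonempty⊈[] (_ ∷ _) ()
⊆-∷ʳ⁻          (v ∷ u) (v ∷ʳ t)     with ⊆-∷ʳ⁻ u t
... | inj₁ t′        = inj₁ (v ∷ʳ t′)
... | inj₂ (eq , t′) = inj₂ (eq , v ∷ʳ t′)
⊆-∷ʳ⁻ {[]}     (v ∷ u) (refl ∷ t)   = inj₁ (refl ∷ minimum u)
⊆-∷ʳ⁻ {_ ∷ xs} (v ∷ u) (refl ∷ t)   with ⊆-∷ʳ⁻ u t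
... | inj₁ t′        = inj₁ (refl ∷ t′)
... | inj₂ (eq , t′) = inj₂ (eq , refl ∷ t′)

∈∧∈⇒⊆ : ∀ {a b : ℕ} {ρ} → a ∈ ρ → b ∈ ρ → a ≢ b → a ∷ b ∷ [] ⊆ ρ ⊎ b ∷ a ∷ [] ⊆ ρ
∈∧∈⇒⊆ (here refl) (here refl) a≢b = ⊥-elim (a≢b refl)
∈∧∈⇒⊆ (here refl) (there b∈)  _   = inj₁ (refl ∷ from∈ b∈)
∈∧∈⇒⊆ (there a∈)  (here refl) _   = inj₂ (refl ∷ from∈ a∈)
∈∧∈⇒⊆ (there a∈)  (there b∈)  a≢b with ∈∧∈⇒⊆ a∈ b∈ a≢b
... | inj₁ t = inj₁ (_ ∷ʳ t)
... | inj₂ t = inj₂ (_ ∷ʳ t)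

⊆-map⁻ : ∀ (f : ℕ → ℕ) {xs} ys → xs ⊆ map f ys → ∃[ xs′ ] (xs′ ⊆ ys × map f xs′ ≡ xs)
⊆-map⁻ f []       []         = [] , [] , refl
⊆-map⁻ f (y ∷ ys) (_ ∷ʳ t)   = let xs′ , t′ , eq = ⊆-map⁻ f ys t in xs′ , y ∷ʳ t′ , eq
⊆-map⁻ f (y ∷ ys) (refl ∷ t) = let xs′ , t′ , eq = ⊆-map⁻ f ys t in y ∷ xs′ , refl ∷ t′ , cong (f y ∷_) eq

⊆-dropPair : ∀ (u : List ℕ) {e s} → u ++ s ⊆ u ++ e ∷ e ∷ s
⊆-dropPair u = ⊆.++⁺ ⊆-refl (_ ∷ʳ _ ∷ʳ ⊆-refl)

occ-self : ∀ a w → occ a (a ∷ w) ≡ suc (occ a w)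
occ-self a w rewrite ≡ᵇ-refl a = refl

occ-other : ∀ {a x} w → a ≢ x → occ a (x ∷ w) ≡ occ a w
occ-other w a≢x rewrite ≢⇒≡ᵇ≡false a≢x = refl

occ-++ : ∀ a u v → occ a (u ++ v) ≡ occ a u + occ a v
occ-++ a []      v = refl
occ-++ a (x ∷ u) v with a ≡ᵇ x
... | true  = cong suc (occ-++ a u v)
... | false = occ-++ a u v

occ-insertSelf : ∀ a u s → occ a (u ++ a ∷ a ∷ s) ≡ 2 + occ a (u ++ s)
occ-insertSelf a []      s = trans (occ-self a (a ∷ s)) (cong suc (occ-self a s))
occ-insertSelf a (x ∷ u) s with a ≡ᵇ x
... | true  = cong suc (occ-insertSelf a u s)
... | false = occ-insertSelf a u s

occ-insertOther : ∀ {a e} u s → a ≢ e → occ a (u ++ e ∷ e ∷ s) ≡ occ a (u ++ s)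
occ-insertOther     []      s a≢e = trans (occ-other (_ ∷ s) a≢e) (occ-other s a≢e)
occ-insertOther {a} (x ∷ u) s a≢e with a ≡ᵇ x
... | true  = cong suc (occ-insertOther u s a≢e)
... | false = occ-insertOther u s a≢e

occ-map-suc : ∀ a w → occ (suc a) (map suc w) ≡ occ a w
occ-map-suc a []      = refl
occ-map-suc a (x ∷ w) with a ≡ᵇ x
... | true  = cong suc (occ-map-suc a w)
... | false = occ-map-suc a w

occ>0⇒∈ : ∀ {a w} → 0 < occ a w → a ∈ w
occ>0⇒∈ {a} {x ∷ w} pos with a ≡ᵇ x in eq
... | true  = here (≡ᵇ≡true⇒≡ eq)
... | false = there (occ>0⇒∈ pos)

∈⇒occ>0 : ∀ {a w} → a ∈ w → 0 < occ a w
∈⇒occ>0 {a} {_ ∷ w} (here refl) rewrite occ-self a w = s≤s z≤n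
∈⇒occ>0 {a} {x ∷ _} (there a∈) with a ≡ᵇ x
... | true  = s≤s z≤n
... | false = ∈⇒occ>0 a∈

∉⇒occ≡0 : ∀ {a w} → a ∉ w → occ a w ≡ 0
∉⇒occ≡0 a∉ = n≤0⇒n≡0 (≮⇒≥ (a∉ ∘ occ>0⇒∈))

Unique⇒occ≤1 : ∀ {a w} → Unique w → occ a w ≤ 1
Unique⇒occ≤1 {w = []}    _ = z≤n
Unique⇒occ≤1 {a} {x ∷ w} (x∉w ∷ w!) with a ≡ᵇ x in eq
... | true  = s≤s (≤-reflexive (∉⇒occ≡0 λ a∈ → All.lookup x∉w a∈ (sym (≡ᵇ≡true⇒≡ eq))))
... | false = Unique⇒occ≤1 w!

∈-prefix : ∀ {a} ρ τ → occ a (ρ ++ τ) ≡ 2 → occ a τ ≤ 1 → a ∈ ρ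
∈-prefix {a} ρ τ twice few with occ a ρ in eq | trans (sym (occ-++ a ρ τ)) twice
... | zero  | τ-twice = ⊥-elim (1+n≰n (subst (_≤ 1) τ-twice few))
... | suc _ | _       = occ>0⇒∈ (subst (0 <_) (sym eq) (s≤s z≤n))

-- Inserting and removing a pair of extreme letters

length-insertPair : ∀ (u : List ℕ) {e} s → length (u ++ e ∷ e ∷ s) ≡ 2 + length (u ++ s)
length-insertPair []      s = refl
length-insertPair (_ ∷ u) s = cong suc (length-insertPair u s)

double-suc : ∀ n → suc n + suc n ≡ 2 + (n + n)
double-suc n = cong suc (+-suc n n)

top-letter : ∀ {n} → Letter (suc n) (suc n)
top-letter = s≤s z≤n , ≤-refl

bottom-letter : ∀ {n} → Letter (suc n) 1
bottom-letter = ≤-refl , s≤s z≤n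

weaken-letter : ∀ {n x} → Letter n x → Letter (suc n) x
weaken-letter (1≤x , x≤n) = 1≤x , m≤n⇒m≤1+n x≤n

shift-letter : ∀ {n x} → Letter n x → Letter (suc n) (suc x)
shift-letter (_ , x≤n) = s≤s z≤n , s≤s x≤n

All-insertPair : ∀ {P : ℕ → Set} (u : List ℕ) {e s} → P e → All P (u ++ s) → All P (u ++ e ∷ e ∷ s)
All-insertPair u pe ps = let pu , ps′ = All.++⁻ u ps in All.++⁺ pu (pe ∷ pe ∷ ps′)

InSnn-insertTop : ∀ {n} u s → InSnn n (u ++ s) → InSnn (suc n) (u ++ suc n ∷ suc n ∷ s)
InSnn-insertTop {n} u s p = record
  { length≡ = trans (length-insertPair u s) (trans (cong (2 +_) length≡) (sym (double-suc n)))
  ; letters = All-insertPair u top-letter (All.map weaken-letter letters)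
  ; twice   = twice′
  }
  where
  open InSnn p
  twice′ : ∀ {a} → Letter (suc n) a → occ a (u ++ suc n ∷ suc n ∷ s) ≡ 2
  twice′ {a} (1≤a , a≤1+n) with a ≟ suc n
  ... | yes refl =
    trans (occ-insertSelf _ u s) (cong (2 +_) (∉⇒occ≡0 λ a∈ → 1+n≰n (proj₂ (All.lookup letters a∈))))
  ... | no  a≢N  = trans (occ-insertOther u s a≢N) (twice (1≤a , ≤-pred (≤∧≢⇒< a≤1+n a≢N)))

InSnn-removeTop : ∀ {n} u s → InSnn (suc n) (u ++ suc n ∷ suc n ∷ s) → InSnn n (u ++ s)
InSnn-removeTop {n} u s p = record
  { length≡ = +-cancelˡ-≡ 2 _ _ (trans (sym (length-insertPair u s)) (trans length≡ (double-suc n)))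
  ; letters = All.tabulate lower
  ; twice   = λ a-ok → trans (sym (occ-insertOther u s (<⇒≢ (s≤s (proj₂ a-ok))))) (twice (weaken-letter a-ok))
  }
  where
  open InSnn p
  N∉ : suc n ∉ u ++ s
  N∉ N∈ = <⇒≢ (∈⇒occ>0 N∈) (sym (+-cancelˡ-≡ 2 _ _ (trans (sym (occ-insertSelf _ u s)) (twice top-letter))))
  lower : ∀ {x} → x ∈ u ++ s → Letter n x
  lower {x} x∈ with All.lookup letters (⊆.Any-resp-⊆ (⊆-dropPair u) x∈)
  ... | 1≤x , x≤N = 1≤x , ≤-pred (≤∧≢⇒< x≤N λ { refl → N∉ x∈ })

1∉map-suc : ∀ {n w} → All (Letter n) w → 1 ∉ map suc w
1∉map-suc letters 1∈ with ∈-map⁻ suc 1∈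
... | _ , x∈ , refl with All.lookup letters x∈
... | () , _

unshift : ∀ {n xs} → All (λ x → 2 ≤ x × x ≤ suc n) xs → ∃[ w ] (xs ≡ map suc w × All (Letter n) w)
unshift []                                           = [] , refl , []
unshift {xs = suc x ∷ _} ((s≤s 1≤x , s≤s x≤n) ∷ rest) =
  let w , eq , w-letters = unshift rest in x ∷ w , cong (suc x ∷_) eq , (1≤x , x≤n) ∷ w-letters

InSnn-insertBottom : ∀ {n} u s {w} → u ++ s ≡ map suc w → InSnn n w → InSnn (suc n) (u ++ 1 ∷ 1 ∷ s)
InSnn-insertBottom {n} u s {w} eq p = record
  { length≡ = trans (length-insertPair u s) (trans (cong (2 +_) length-u++s) (sym (double-suc n)))
  ; letters = All-insertPair u bottom-letter (subst (All _) (sym eq) (All.map⁺ (All.map shift-letter letters)))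
  ; twice   = twice′
  }
  where
  open InSnn p
  length-u++s : length (u ++ s) ≡ n + n
  length-u++s = trans (cong length eq) (trans (length-map suc w) length≡)
  twice′ : ∀ {a} → Letter (suc n) a → occ a (u ++ 1 ∷ 1 ∷ s) ≡ 2
  twice′ {suc zero} _ =
    trans (occ-insertSelf 1 u s) (cong (2 +_) (trans (cong (occ 1) eq) (∉⇒occ≡0 (1∉map-suc letters))))
  twice′ {suc (suc b)} (_ , a≤N) = begin
    occ (2 + b) (u ++ 1 ∷ 1 ∷ s) ≡⟨ occ-insertOther u s (λ ()) ⟩
    occ (2 + b) (u ++ s)         ≡⟨ cong (occ (2 + b)) eq ⟩
    occ (2 + b) (map suc w)      ≡⟨ occ-map-suc (suc b) w ⟩
    occ (suc b) w                ≡⟨ twice (s≤s z≤n , ≤-pred a≤N) ⟩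
    2                            ∎
    where open ≡-Reasoning

InSnn-removeBottom : ∀ {n} u s → InSnn (suc n) (u ++ 1 ∷ 1 ∷ s) → ∃[ w ] (u ++ s ≡ map suc w × InSnn n w)
InSnn-removeBottom {n} u s p =
  let w , eq , w-letters = unshift (All.tabulate above1) in
  w , eq , record
    { length≡ = begin
        length w            ≡⟨ sym (length-map suc w) ⟩
        length (map suc w)  ≡⟨ cong length (sym eq) ⟩
        length (u ++ s)     ≡⟨ +-cancelˡ-≡ 2 _ _ (trans (sym (length-insertPair u s)) (trans length≡ (double-suc n))) ⟩
        n + n               ∎
    ; letters = w-letters
    ; twice   = λ {a} a-ok → begin
        occ a w                      ≡⟨ sym (occ-map-suc a w) ⟩
        occ (suc a) (map suc w)      ≡⟨ cong (occ (suc a)) (sym eq) ⟩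
        occ (suc a) (u ++ s)         ≡⟨ sym (occ-insertOther u s (>⇒≢ (s≤s (proj₁ a-ok)))) ⟩
        occ (suc a) (u ++ 1 ∷ 1 ∷ s) ≡⟨ twice (shift-letter a-ok) ⟩
        2                            ∎
    }
  where
  open ≡-Reasoning
  open InSnn p
  1∉ : 1 ∉ u ++ s
  1∉ 1∈ = <⇒≢ (∈⇒occ>0 1∈) (sym (+-cancelˡ-≡ 2 _ _ (trans (sym (occ-insertSelf 1 u s)) (twice bottom-letter))))
  above1 : ∀ {x} → x ∈ u ++ s → 2 ≤ x × x ≤ suc n
  above1 x∈ with All.lookup letters (⊆.Any-resp-⊆ (⊆-dropPair u) x∈)
  ... | 1≤x , x≤N = ≤∧≢⇒< 1≤x (λ { refl → 1∉ x∈ }) , x≤N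

Between-sym : ∀ {a c b} → Between a c b → Between b c a
Between-sym (inj₁ p) = inj₂ p
Between-sym (inj₂ p) = inj₁ p

Between⇒≢ : ∀ {a c b} → Between a c b → a ≢ b
Between⇒≢ (inj₁ (p , q)) refl = <-asym p q
Between⇒≢ (inj₂ (p , q)) refl = <-asym p q

Between-suc⁺ : ∀ {a c b} → Between a c b → Between (suc a) (suc c) (suc b)
Between-suc⁺ (inj₁ (p , q)) = inj₁ (s≤s p , s≤s q)
Between-suc⁺ (inj₂ (p , q)) = inj₂ (s≤s p , s≤s q)

Between-suc⁻ : ∀ {a c b} → Between (suc a) (suc c) (suc b) → Between a c b
Between-suc⁻ (inj₁ (p , q)) = inj₁ (≤-pred p , ≤-pred q)
Between-suc⁻ (inj₂ (p , q)) = inj₂ (≤-pred p , ≤-pred q)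

NoBetween-⊆ : ∀ {u π} → u ⊆ π → NoBetween π → NoBetween u
NoBetween-⊆ u⊆π nb t = nb (⊆-trans t u⊆π)

NoCrossing-⊆ : ∀ {u π} → u ⊆ π → NoCrossing π → NoCrossing u
NoCrossing-⊆ u⊆π nc t = nc (⊆-trans t u⊆π)

NoBetween-map-suc⁺ : ∀ {w} → NoBetween w → NoBetween (map suc w)
NoBetween-map-suc⁺ {w} nb t btw with ⊆-map⁻ suc w t
... | _ ∷ _ ∷ _ ∷ [] , t′ , refl = nb t′ (Between-suc⁻ btw)

NoBetween-map-suc⁻ : ∀ {w} → NoBetween (map suc w) → NoBetween w
NoBetween-map-suc⁻ nb t btw = nb (⊆.map⁺ suc t) (Between-suc⁺ btw)

NoCrossing-map-suc⁺ : ∀ {w} → NoCrossing w → NoCrossing (map suc w)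
NoCrossing-map-suc⁺ {w} nc t with ⊆-map⁻ suc w t
... | _ ∷ _ ∷ _ ∷ _ ∷ [] , t′ , refl = cong suc (nc t′)

NoCrossing-map-suc⁻ : ∀ {w} → NoCrossing (map suc w) → NoCrossing w
NoCrossing-map-suc⁻ nc t = suc-injective (nc (⊆.map⁺ suc t))

NoBetween⇒¬Between-earlier : ∀ {ρ x τ a b} → NoBetween (ρ ++ x ∷ τ) → a ∈ ρ → b ∈ ρ → ¬ Between a x b
NoBetween⇒¬Between-earlier {τ = τ} nb a∈ b∈ btw with ∈∧∈⇒⊆ a∈ b∈ (Between⇒≢ btw)
... | inj₁ t = nb (⊆.++⁺ t (refl ∷ minimum τ)) btw
... | inj₂ t = nb (⊆.++⁺ t (refl ∷ minimum τ)) (Between-sym btw)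

Bounds : ℕ → List ℕ → Set
Bounds e u = All (e ≤_) u ⊎ All (_≤ e) u

Bounds-∷ʳ : ∀ {e u} → Bounds e u → Bounds e (u ++ [ e ])
Bounds-∷ʳ (inj₁ below) = inj₁ (All.++⁺ below (≤-refl ∷ []))
Bounds-∷ʳ (inj₂ above) = inj₂ (All.++⁺ above (≤-refl ∷ []))

Bounds⇒¬Between : ∀ {e u a b} → Bounds e u → a ∈ u → b ∈ u → ¬ Between a e b
Bounds⇒¬Between (inj₁ below) a∈ b∈ (inj₁ (a<e , _)) = <⇒≱ a<e (All.lookup below a∈)
Bounds⇒¬Between (inj₁ below) a∈ b∈ (inj₂ (b<e , _)) = <⇒≱ b<e (All.lookup below b∈)
Bounds⇒¬Between (inj₂ above) a∈ b∈ (inj₁ (_ , e<b)) = <⇒≱ e<b (All.lookup above b∈)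
Bounds⇒¬Between (inj₂ above) a∈ b∈ (inj₂ (_ , e<a)) = <⇒≱ e<a (All.lookup above a∈)

NoBetween-∷ʳ : ∀ {u e} → NoBetween u → Bounds e u → NoBetween (u ++ [ e ])
NoBetween-∷ʳ {u} nb ext {a} {b} t with ⊆-∷ʳ⁻ {a ∷ b ∷ []} u t
... | inj₁ t′          = nb t′
... | inj₂ (refl , t′) = Bounds⇒¬Between ext (⊆.Any-resp-⊆ t′ 1st) (⊆.Any-resp-⊆ t′ 2nd)

NoCrossing-∷ʳ : ∀ {u x} → NoCrossing u → (∀ {a} → a ∷ x ∷ a ∷ [] ⊆ u → a ≡ x) → NoCrossing (u ++ [ x ])
NoCrossing-∷ʳ {u} nc closes {a} {b} t with ⊆-∷ʳ⁻ {a ∷ b ∷ a ∷ []} u t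
... | inj₁ t′          = nc t′
... | inj₂ (refl , t′) = closes t′

appendFreshPair : ∀ {u e} → e ∉ u → Bounds e u → NoCrossing u → NoBetween u →
                  NoCrossing (u ++ [ e ] ++ [ e ]) × NoBetween (u ++ [ e ] ++ [ e ])
appendFreshPair {u} {e} e∉u ext nc nb =
  subst NoCrossing (++-assoc u _ _) (NoCrossing-∷ʳ (NoCrossing-∷ʳ nc fresh) closes) ,
  subst NoBetween (++-assoc u _ _) (NoBetween-∷ʳ (NoBetween-∷ʳ nb ext) (Bounds-∷ʳ ext))
  where
  fresh : ∀ {a} → a ∷ e ∷ a ∷ [] ⊆ u → a ≡ e
  fresh t = ⊥-elim (e∉u (⊆.Any-resp-⊆ t 2nd))
  closes : ∀ {a} → a ∷ e ∷ a ∷ [] ⊆ u ++ [ e ] → a ≡ e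
  closes {a} t with ⊆-∷ʳ⁻ {a ∷ e ∷ []} u t
  ... | inj₁ t′         = fresh t′
  ... | inj₂ (a≡e , _)  = a≡e

insertFreshPairBeforeLast : ∀ {u e f} → e ∉ u → Bounds e u → Bounds f (u ++ e ∷ e ∷ []) →
  NoCrossing (u ++ [ f ]) → NoBetween u → NoCrossing (u ++ e ∷ e ∷ f ∷ []) × NoBetween (u ++ e ∷ e ∷ f ∷ [])
insertFreshPairBeforeLast {u} {e} {f} e∉u ext extf nc nb =
  subst NoCrossing (++-assoc u _ _) (NoCrossing-∷ʳ (proj₁ pair) closes) ,
  subst NoBetween (++-assoc u _ _) (NoBetween-∷ʳ (proj₂ pair) extf)
  where
  pair : NoCrossing (u ++ e ∷ e ∷ []) × NoBetween (u ++ e ∷ e ∷ [])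
  pair = appendFreshPair e∉u ext (NoCrossing-⊆ (⊆.++⁺ʳ [ f ] ⊆-refl) nc) nb
  closes : ∀ {a} → a ∷ f ∷ a ∷ [] ⊆ u ++ e ∷ e ∷ [] → a ≡ f
  closes {a} t with ⊆-∷ʳ⁻ {a ∷ f ∷ []} (u ++ [ e ]) (subst (a ∷ f ∷ a ∷ [] ⊆_) (sym (++-assoc u [ e ] [ e ])) t)
  ... | inj₂ (refl , t′) with ⊆-∷ʳ⁻ {a ∷ []} u t′
  ...   | inj₁ t″        = ⊥-elim (e∉u (⊆.Any-resp-⊆ t″ 1st))
  ...   | inj₂ (f≡a , _) = sym f≡a
  closes {a} t | inj₁ t′ with ⊆-∷ʳ⁻ {a ∷ f ∷ []} u t′
  ...   | inj₁ t″         = nc (⊆.++⁺ t″ (refl ∷ []))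
  ...   | inj₂ (refl , t″) = ⊥-elim (e∉u (⊆.Any-resp-⊆ t″ 1st))

-- Parents and children

InQbar-removeTop : ∀ {n} u s → InQbar (suc n) (u ++ suc n ∷ suc n ∷ s) → InQbar n (u ++ s)
InQbar-removeTop u s q = record
  { inSnn      = InSnn-removeTop u s inSnn
  ; noCrossing = NoCrossing-⊆ (⊆-dropPair u) noCrossing
  ; noBetween  = NoBetween-⊆ (⊆-dropPair u) noBetween
  }
  where open InQbar q

InQbar-removeBottom : ∀ {n} u s → InQbar (suc n) (u ++ 1 ∷ 1 ∷ s) → ∃[ w ] (u ++ s ≡ map suc w × InQbar n w)
InQbar-removeBottom u s q =
  let w , eq , w-inSnn = InSnn-removeBottom u s inSnn in
  w , eq , record
    { inSnn      = w-inSnn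
    ; noCrossing = NoCrossing-map-suc⁻ (subst NoCrossing eq (NoCrossing-⊆ (⊆-dropPair u) noCrossing))
    ; noBetween  = NoBetween-map-suc⁻ (subst NoBetween eq (NoBetween-⊆ (⊆-dropPair u) noBetween))
    }
  where open InQbar q

Extreme : ℕ → ℕ → Set
Extreme N x = x ≡ 1 ⊎ x ≡ N

lateLetter-extreme : ∀ {N} ρ {x} τ → 1 ≤ N → InQbar N (ρ ++ x ∷ τ) → Unique (x ∷ τ) → Extreme N x
lateLetter-extreme {N} ρ {x} τ 1≤N q distinct with x ≟ 1 | x ≟ N
... | yes x≡1 | _       = inj₁ x≡1
... | no _    | yes x≡N = inj₂ x≡N
... | no x≢1  | no x≢N  = ⊥-elim (NoBetween⇒¬Between-earlier noBetween 1∈ρ N∈ρ (inj₁ (1<x , x<N)))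
  where
  open InQbar q
  x-ok : Letter N x
  x-ok = All.lookup letters (∈-++⁺ʳ ρ 1st)
  1<x : 1 < x
  1<x = ≤∧≢⇒< (proj₁ x-ok) (x≢1 ∘ sym)
  x<N : x < N
  x<N = ≤∧≢⇒< (proj₂ x-ok) x≢N
  1∈ρ : 1 ∈ ρ
  1∈ρ = ∈-prefix ρ (x ∷ τ) (twice (≤-refl , 1≤N)) (Unique⇒occ≤1 distinct)
  N∈ρ : N ∈ ρ
  N∈ρ = ∈-prefix ρ (x ∷ τ) (twice (1≤N , ≤-refl)) (Unique⇒occ≤1 distinct)

lastLetter : List ℕ → ℕ
lastLetter []          = 0
lastLetter (x ∷ [])    = x
lastLetter (_ ∷ y ∷ w) = lastLetter (y ∷ w)

insertBeforeLast : ℕ → List ℕ → List ℕ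
insertBeforeLast e []          = []
insertBeforeLast e (x ∷ [])    = e ∷ e ∷ x ∷ []
insertBeforeLast e (x ∷ y ∷ w) = x ∷ insertBeforeLast e (y ∷ w)

lastLetter-∷ʳ : ∀ v x → lastLetter (v ++ [ x ]) ≡ x
lastLetter-∷ʳ []          x = refl
lastLetter-∷ʳ (_ ∷ [])    x = refl
lastLetter-∷ʳ (_ ∷ y ∷ v) x = lastLetter-∷ʳ (y ∷ v) x

insertBeforeLast-∷ʳ : ∀ e v x → insertBeforeLast e (v ++ [ x ]) ≡ v ++ e ∷ e ∷ x ∷ []
insertBeforeLast-∷ʳ e []          x = refl
insertBeforeLast-∷ʳ e (y ∷ [])    x = refl
insertBeforeLast-∷ʳ e (y ∷ z ∷ v) x = cong (y ∷_) (insertBeforeLast-∷ʳ e (z ∷ v) x)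

innerChild : ℕ → List ℕ → List ℕ
innerChild n w = if lastLetter w ≡ᵇ 1 then insertBeforeLast (suc n) w else insertBeforeLast 1 (map suc w)

children : ℕ → List ℕ → List (List ℕ)
children n w = (w ++ suc n ∷ suc n ∷ []) ∷ (map suc w ++ 1 ∷ 1 ∷ []) ∷ innerChild n w ∷ []

innerChild-1 : ∀ n v → innerChild n (v ++ [ 1 ]) ≡ v ++ suc n ∷ suc n ∷ 1 ∷ []
innerChild-1 n v rewrite lastLetter-∷ʳ v 1 = insertBeforeLast-∷ʳ (suc n) v 1

innerChild-≢1 : ∀ n v {x} → x ≢ 1 → innerChild n (v ++ [ x ]) ≡ map suc v ++ 1 ∷ 1 ∷ suc x ∷ []
innerChild-≢1 n v {x} x≢1 rewrite lastLetter-∷ʳ v x | ≢⇒≡ᵇ≡false x≢1 | map-++ suc v [ x ] =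
  insertBeforeLast-∷ʳ 1 (map suc v) (suc x)

top∉ : ∀ {n w} → All (Letter n) w → suc n ∉ w
top∉ letters N∈ = 1+n≰n (proj₂ (All.lookup letters N∈))

below-top : ∀ {n w} → All (Letter n) w → All (_≤ suc n) w
below-top = All.map (m≤n⇒m≤1+n ∘ proj₂)

above-bottom : ∀ w → All (1 ≤_) (map suc w)
above-bottom w = All.map⁺ (All.universal (λ _ → s≤s z≤n) w)

topChild-InQbar : ∀ {n w} → InQbar n w → InQbar (suc n) (w ++ suc n ∷ suc n ∷ [])
topChild-InQbar {n} {w} q = record
  { inSnn      = InSnn-insertTop w [] (subst (InSnn n) (sym (++-identityʳ w)) inSnn)
  ; noCrossing = proj₁ pair
  ; noBetween  = proj₂ pair
  }
  where
  open InQbar q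
  pair : NoCrossing (w ++ suc n ∷ suc n ∷ []) × NoBetween (w ++ suc n ∷ suc n ∷ [])
  pair = appendFreshPair (top∉ letters) (inj₂ (below-top letters)) noCrossing noBetween

bottomChild-InQbar : ∀ {n w} → InQbar n w → InQbar (suc n) (map suc w ++ 1 ∷ 1 ∷ [])
bottomChild-InQbar {n} {w} q = record
  { inSnn      = InSnn-insertBottom (map suc w) [] (++-identityʳ _) inSnn
  ; noCrossing = proj₁ pair
  ; noBetween  = proj₂ pair
  }
  where
  open InQbar q
  pair : NoCrossing (map suc w ++ 1 ∷ 1 ∷ []) × NoBetween (map suc w ++ 1 ∷ 1 ∷ [])
  pair = appendFreshPair (1∉map-suc letters) (inj₁ (above-bottom w))
                         (NoCrossing-map-suc⁺ noCrossing) (NoBetween-map-suc⁺ noBetween)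

insertTopBeforeLast-InQbar : ∀ {n v} → InQbar n (v ++ [ 1 ]) → InQbar (suc n) (v ++ suc n ∷ suc n ∷ 1 ∷ [])
insertTopBeforeLast-InQbar {n} {v} q = record
  { inSnn      = InSnn-insertTop v [ 1 ] inSnn
  ; noCrossing = proj₁ pair
  ; noBetween  = proj₂ pair
  }
  where
  open InQbar q
  v-letters : All (Letter n) v
  v-letters = All.++⁻ˡ v letters
  pair : NoCrossing (v ++ suc n ∷ suc n ∷ 1 ∷ []) × NoBetween (v ++ suc n ∷ suc n ∷ 1 ∷ [])
  pair = insertFreshPairBeforeLast (top∉ v-letters) (inj₂ (below-top v-letters))
           (inj₁ (All.++⁺ (All.map proj₁ v-letters) (s≤s z≤n ∷ s≤s z≤n ∷ [])))
           noCrossing (NoBetween-⊆ (⊆.++⁺ʳ [ 1 ] ⊆-refl) noBetween)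

insertBottomBeforeLast-InQbar : ∀ {n v} → InQbar n (v ++ [ n ]) →
                                InQbar (suc n) (map suc v ++ 1 ∷ 1 ∷ suc n ∷ [])
insertBottomBeforeLast-InQbar {n} {v} q = record
  { inSnn      = InSnn-insertBottom (map suc v) [ suc n ] (sym (map-++ suc v [ n ])) inSnn
  ; noCrossing = proj₁ pair
  ; noBetween  = proj₂ pair
  }
  where
  open InQbar q
  v-letters : All (Letter n) v
  v-letters = All.++⁻ˡ v letters
  pair : NoCrossing (map suc v ++ 1 ∷ 1 ∷ suc n ∷ []) × NoBetween (map suc v ++ 1 ∷ 1 ∷ suc n ∷ [])
  pair = insertFreshPairBeforeLast (1∉map-suc v-letters) (inj₁ (above-bottom v))
           (inj₂ (All.++⁺ (All.map⁺ (All.map (s≤s ∘ proj₂) v-letters)) (s≤s z≤n ∷ s≤s z≤n ∷ [])))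
           (subst NoCrossing (map-++ suc v [ n ]) (NoCrossing-map-suc⁺ noCrossing))
           (NoBetween-map-suc⁺ (NoBetween-⊆ (⊆.++⁺ʳ [ n ] ⊆-refl) noBetween))

nonempty : ∀ {n w} → 1 ≤ n → InQbar n w → w ≢ []
nonempty {n} 1≤n q refl = <⇒≢ (≤-trans 1≤n (m≤m+n n n)) (InQbar.length≡ q)

data LastLetter (n : ℕ) : List ℕ → Set where
  endsIn1 : ∀ v → LastLetter n (v ++ [ 1 ])
  endsInN : ∀ v → n ≢ 1 → LastLetter n (v ++ [ n ])

lastLetter-view : ∀ {n w} → 1 ≤ n → InQbar n w → LastLetter n w
lastLetter-view {w = w} 1≤n q with initLast w
... | []      = ⊥-elim (nonempty 1≤n q refl)
... | v ∷ʳ′ x with x ≟ 1 | lateLetter-extreme v [] 1≤n q ([] ∷ [])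
...   | yes refl | _         = endsIn1 v
...   | no x≢1   | inj₁ x≡1  = ⊥-elim (x≢1 x≡1)
...   | no x≢1   | inj₂ refl = endsInN v x≢1

innerChild-InQbar : ∀ {n w} → 1 ≤ n → InQbar n w → InQbar (suc n) (innerChild n w)
innerChild-InQbar {n} 1≤n q with lastLetter-view 1≤n q
... | endsIn1 v     rewrite innerChild-1 n v     = insertTopBeforeLast-InQbar q
... | endsInN v n≢1 rewrite innerChild-≢1 n v n≢1 = insertBottomBeforeLast-InQbar q

children-InQbar : ∀ {n w π} → 1 ≤ n → InQbar n w → π ∈ children n w → InQbar (suc n) π
children-InQbar _   q 1st = topChild-InQbar q
children-InQbar _   q 2nd = bottomChild-InQbar q
children-InQbar 1≤n q 3rd = innerChild-InQbar 1≤n q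

data Ending (N : ℕ) : List ℕ → Set where
  endsNN  : ∀ α → Ending N (α ++ N ∷ N ∷ [])
  ends11  : ∀ α → Ending N (α ++ 1 ∷ 1 ∷ [])
  endsNN1 : ∀ σ → Ending N (σ ++ N ∷ N ∷ 1 ∷ [])
  ends11N : ∀ σ → Ending N (σ ++ 1 ∷ 1 ∷ N ∷ [])

splitLast3 : ∀ (π : List ℕ) → 3 ≤ length π → ∃[ σ ] ∃[ p ] ∃[ q ] ∃[ r ] π ≡ σ ++ p ∷ q ∷ r ∷ []
splitLast3 (_ ∷ [])            (s≤s ())
splitLast3 (_ ∷ _ ∷ [])        (s≤s (s≤s ()))
splitLast3 (p ∷ q ∷ r ∷ [])     _ = [] , p , q , r , refl
splitLast3 (x ∷ y ∷ z ∷ w ∷ π) _ =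
  let σ , p , q , r , eq = splitLast3 (y ∷ z ∷ w ∷ π) (s≤s (s≤s (s≤s z≤n))) in x ∷ σ , p , q , r , cong (x ∷_) eq

pairEnding : ∀ {N} α {r} → Extreme N r → Ending N (α ++ r ∷ r ∷ [])
pairEnding α (inj₁ refl) = ends11 α
pairEnding α (inj₂ refl) = endsNN α

tripleEnding : ∀ {N} σ {q r} → Extreme N q → Extreme N r → q ≢ r → Ending N (σ ++ q ∷ q ∷ r ∷ [])
tripleEnding σ (inj₁ refl) (inj₂ refl) _   = ends11N σ
tripleEnding σ (inj₂ refl) (inj₁ refl) _   = endsNN1 σ
tripleEnding σ (inj₁ refl) (inj₁ refl) q≢r = ⊥-elim (q≢r refl)
tripleEnding σ (inj₂ refl) (inj₂ refl) q≢r = ⊥-elim (q≢r refl)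

Extreme-covers : ∀ {N x y z} → Extreme N y → Extreme N z → y ≢ z → Extreme N x → x ≡ y ⊎ x ≡ z
Extreme-covers (inj₁ refl) (inj₂ refl) _   x-ext = x-ext
Extreme-covers (inj₂ refl) (inj₁ refl) _   x-ext = Sum.swap x-ext
Extreme-covers (inj₁ refl) (inj₁ refl) y≢z _     = ⊥-elim (y≢z refl)
Extreme-covers (inj₂ refl) (inj₂ refl) y≢z _     = ⊥-elim (y≢z refl)

¬endsWithCrossing : ∀ {N} σ {q r} → q ≢ r → InQbar N (σ ++ r ∷ q ∷ r ∷ []) → ⊥
¬endsWithCrossing σ {q} {r} q≢r ok = q≢r (noCrossing (⊆.++⁺ (from∈ q∈σ) ⊆-refl))
  where
  open InQbar ok
  once : occ q (r ∷ q ∷ r ∷ []) ≤ 1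
  once = ≤-reflexive (trans (occ-other (q ∷ r ∷ []) q≢r)
                            (trans (occ-self q (r ∷ [])) (cong suc (occ-other [] q≢r))))
  q∈σ : q ∈ σ
  q∈σ = ∈-prefix σ _ (twice (All.lookup letters (∈-++⁺ʳ σ 2nd))) once

endingOfLastThree : ∀ {N} σ p q r → 1 ≤ N → InQbar N (σ ++ p ∷ q ∷ r ∷ []) → Ending N (σ ++ p ∷ q ∷ r ∷ [])
endingOfLastThree {N} σ p q r 1≤N ok
  with lateLetter-extreme (σ ++ p ∷ q ∷ []) [] 1≤N (subst (InQbar N) (sym (++-assoc σ _ [ r ])) ok) ([] ∷ [])
     | q ≟ r
... | r-ext | yes refl = subst (Ending N) (++-assoc σ [ p ] _) (pairEnding (σ ++ [ p ]) r-ext)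
... | r-ext | no q≢r
  with lateLetter-extreme (σ ++ [ p ]) [ r ] 1≤N (subst (InQbar N) (sym (++-assoc σ [ p ] _)) ok)
                         ((q≢r ∷ []) ∷ [] ∷ [])
     | p ≟ q | p ≟ r
...   | q-ext | yes refl | _        = tripleEnding σ q-ext r-ext q≢r
...   | _     | no _     | yes refl = ⊥-elim (¬endsWithCrossing σ q≢r ok)
...   | q-ext | no p≢q   | no p≢r   =
  ⊥-elim (Sum.[ p≢q , p≢r ] (Extreme-covers q-ext r-ext q≢r
    (lateLetter-extreme σ (q ∷ r ∷ []) 1≤N ok ((p≢q ∷ p≢r ∷ []) ∷ (q≢r ∷ []) ∷ [] ∷ []))))

ending : ∀ {N π} → 3 ≤ N → InQbar N π → Ending N π
ending {N} {π} 3≤N ok with splitLast3 π (≤-trans 3≤N (subst (N ≤_) (sym (InQbar.length≡ ok)) (m≤m+n N N)))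
... | σ , p , q , r , refl = endingOfLastThree σ p q r (≤-trans (s≤s z≤n) 3≤N) ok

innerChild-shifted : ∀ n σ {w} → 2 ≤ n → σ ++ [ suc n ] ≡ map suc w → innerChild n w ≡ σ ++ 1 ∷ 1 ∷ suc n ∷ []
innerChild-shifted n σ {w} 2≤n eq with initLast w
... | []      with () ← ++-conicalʳ σ _ eq
... | v ∷ʳ′ x with ∷ʳ-injective σ (map suc v) (trans eq (map-++ suc v [ x ]))
...   | refl , refl = innerChild-≢1 n v (>⇒≢ 2≤n)

hasParent : ∀ {n π} → 2 ≤ n → InQbar (suc n) π → ∃[ w ] (InQbar n w × π ∈ children n w)
hasParent {n} 2≤n ok with ending (s≤s 2≤n) ok
... | endsNN α  = α , subst (InQbar n) (++-identityʳ α) (InQbar-removeTop α [] ok) , 1st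
... | ends11 α  =
  let w , eq , w-ok = InQbar-removeBottom α [] ok in
  w , w-ok , there (here (cong (_++ 1 ∷ 1 ∷ []) (trans (sym (++-identityʳ α)) eq)))
... | endsNN1 σ = σ ++ [ 1 ] , InQbar-removeTop σ [ 1 ] ok , there (there (here (sym (innerChild-1 n σ))))
... | ends11N σ =
  let w , eq , w-ok = InQbar-removeBottom σ [ suc n ] ok in
  w , w-ok , there (there (here (sym (innerChild-shifted n σ 2≤n eq))))

-- The three children of a word are told apart by their last two letters (listed last first).
lastTwo : List ℕ → List ℕ
lastTwo π = take 2 (reverse π)

lastTwo-++ : ∀ u s → lastTwo (u ++ s) ≡ take 2 (reverse s ++ reverse u)
lastTwo-++ u s = cong (take 2) (reverse-++ u s)

endings-differ : ∀ {x y : List ℕ} {a b a′ b′} → lastTwo x ≡ a ∷ b ∷ [] → lastTwo y ≡ a′ ∷ b′ ∷ [] →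
                 a ≢ a′ ⊎ b ≢ b′ → x ≢ y
endings-differ ex ey (inj₁ a≢a′) refl = a≢a′ (∷-injectiveˡ (trans (sym ex) ey))
endings-differ ex ey (inj₂ b≢b′) refl = b≢b′ (∷-injectiveˡ (∷-injectiveʳ (trans (sym ex) ey)))

lastTwo-innerChild : ∀ {n w} → 1 ≤ n → InQbar n w →
  lastTwo (innerChild n w) ≡ 1 ∷ suc n ∷ [] ⊎ lastTwo (innerChild n w) ≡ suc n ∷ 1 ∷ []
lastTwo-innerChild {n} 1≤n q with lastLetter-view 1≤n q
... | endsIn1 v     rewrite innerChild-1 n v     = inj₁ (lastTwo-++ v _)
... | endsInN v n≢1 rewrite innerChild-≢1 n v n≢1 = inj₂ (lastTwo-++ (map suc v) _)

module _ {n : ℕ} (1≤n : 1 ≤ n) where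

  private
    N≢1 : suc n ≢ 1
    N≢1 eq = <⇒≢ 1≤n (sym (suc-injective eq))

  top≢bottom : ∀ w w′ → w ++ suc n ∷ suc n ∷ [] ≢ map suc w′ ++ 1 ∷ 1 ∷ []
  top≢bottom w w′ = endings-differ (lastTwo-++ w _) (lastTwo-++ (map suc w′) _) (inj₁ N≢1)

  top≢inner : ∀ w {w′} → InQbar n w′ → w ++ suc n ∷ suc n ∷ [] ≢ innerChild n w′
  top≢inner w q′ with lastTwo-innerChild 1≤n q′
  ... | inj₁ e = endings-differ (lastTwo-++ w _) e (inj₁ N≢1)
  ... | inj₂ e = endings-differ (lastTwo-++ w _) e (inj₂ N≢1)

  bottom≢inner : ∀ w {w′} → InQbar n w′ → map suc w ++ 1 ∷ 1 ∷ [] ≢ innerChild n w′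
  bottom≢inner w q′ with lastTwo-innerChild 1≤n q′
  ... | inj₁ e = endings-differ (lastTwo-++ (map suc w) _) e (inj₂ (N≢1 ∘ sym))
  ... | inj₂ e = endings-differ (lastTwo-++ (map suc w) _) e (inj₁ (N≢1 ∘ sym))

  innerChild-injective : ∀ {w w′} → InQbar n w → InQbar n w′ → innerChild n w ≡ innerChild n w′ → w ≡ w′
  innerChild-injective q q′ eq with lastLetter-view 1≤n q | lastLetter-view 1≤n q′
  ... | endsIn1 v | endsIn1 v′ =
    cong (_++ [ 1 ]) (++-cancelʳ _ v v′ (trans (sym (innerChild-1 n v)) (trans eq (innerChild-1 n v′))))
  ... | endsInN v n≢1 | endsInN v′ _ =
    cong (_++ [ n ]) (map-injective suc-injective
      (++-cancelʳ _ (map suc v) (map suc v′)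
        (trans (sym (innerChild-≢1 n v n≢1)) (trans eq (innerChild-≢1 n v′ n≢1)))))
  ... | endsIn1 v | endsInN v′ n≢1 =
    ⊥-elim (N≢1 (∷-injectiveˡ (proj₂ (++-injective v (map suc v′) refl
      (trans (sym (innerChild-1 n v)) (trans eq (innerChild-≢1 n v′ n≢1)))))))
  ... | endsInN v n≢1 | endsIn1 v′ =
    ⊥-elim (N≢1 (sym (∷-injectiveˡ (proj₂ (++-injective (map suc v) v′ refl
      (trans (sym (innerChild-≢1 n v n≢1)) (trans eq (innerChild-1 n v′))))))))

  children-unique : ∀ {w} → InQbar n w → Unique (children n w)
  children-unique {w} q = (top≢bottom w w ∷ top≢inner w q ∷ []) ∷ (bottom≢inner w q ∷ []) ∷ [] ∷ []

  sameParent : ∀ {w w′ π} → InQbar n w → InQbar n w′ → π ∈ children n w → π ∈ children n w′ → w ≡ w′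
  sameParent {w} {w′} q q′ 1st (here eq)                 = ++-cancelʳ _ w w′ eq
  sameParent {w} {w′} q q′ 1st (there (here eq))         = ⊥-elim (top≢bottom w w′ eq)
  sameParent {w} {w′} q q′ 1st (there (there (here eq))) = ⊥-elim (top≢inner w q′ eq)
  sameParent {w} {w′} q q′ 2nd (here eq)                 = ⊥-elim (top≢bottom w′ w (sym eq))
  sameParent {w} {w′} q q′ 2nd (there (here eq))         = map-injective suc-injective (++-cancelʳ _ _ _ eq)
  sameParent {w} {w′} q q′ 2nd (there (there (here eq))) = ⊥-elim (bottom≢inner w q′ eq)
  sameParent {w} {w′} q q′ 3rd (here eq)                 = ⊥-elim (top≢inner w′ q (sym eq))
  sameParent {w} {w′} q q′ 3rd (there (here eq))         = ⊥-elim (bottom≢inner w′ q (sym eq))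
  sameParent {w} {w′} q q′ 3rd (there (there (here eq))) = innerChild-injective q q′ eq

length-concatMap : ∀ {A B : Set} (f : A → List B) {k} → (∀ x → length (f x) ≡ k) →
                   ∀ xs → length (concatMap f xs) ≡ k * length xs
length-concatMap f {k} fk []       = sym (*-zeroʳ k)
length-concatMap f {k} fk (x ∷ xs) = begin
  length (f x ++ concatMap f xs)         ≡⟨ length-++ (f x) ⟩
  length (f x) + length (concatMap f xs) ≡⟨ cong₂ _+_ (fk x) (length-concatMap f fk xs) ⟩
  k + k * length xs                      ≡⟨ sym (*-suc k (length xs)) ⟩
  k * suc (length xs)                    ∎
  where open ≡-Reasoning

Unique-⇔⇒length≡ : ∀ {A : Set} {xs ys : List A} → Unique xs → Unique ys → (∀ {x} → x ∈ xs ⇔ x ∈ ys) →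
                   length xs ≡ length ys
Unique-⇔⇒length≡ xs! ys! same = ↭-length (∼bag⇒↭ (unique∧set⇒bag xs! ys! same))

Qbar-suc⇔ : ∀ {n π} → 2 ≤ n → π ∈ Qbar (suc n) Λ ⇔ π ∈ concatMap (children n) (Qbar n Λ)
Qbar-suc⇔ {n} 2≤n = mk⇔ to from
  where
  to : ∀ {π} → π ∈ Qbar (suc n) Λ → π ∈ concatMap (children n) (Qbar n Λ)
  to π∈ with hasParent 2≤n (Equivalence.to ∈-Qbar⇔ π∈)
  ... | w , w-ok , π∈children = ∈-concat⁺′ π∈children (∈-map⁺ (children n) (Equivalence.from ∈-Qbar⇔ w-ok))
  from : ∀ {π} → π ∈ concatMap (children n) (Qbar n Λ) → π ∈ Qbar (suc n) Λ
  from π∈ with ∈-concat⁻′ (map (children n) (Qbar n Λ)) π∈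
  ... | _ , π∈children , cs∈ with ∈-map⁻ (children n) cs∈
  ...   | w , w∈ , refl =
    Equivalence.from ∈-Qbar⇔ (children-InQbar (≤-trans (s≤s z≤n) 2≤n) (Equivalence.to ∈-Qbar⇔ w∈) π∈children)

qbar-suc : ∀ {n} → 2 ≤ n → qbar (suc n) Λ ≡ 3 * qbar n Λ
qbar-suc {n} 2≤n = begin
  length (Qbar (suc n) Λ)
    ≡⟨ Unique-⇔⇒length≡ (Qbar-unique (suc n)) children-all-unique (Qbar-suc⇔ 2≤n) ⟩
  length (concatMap (children n) (Qbar n Λ))
    ≡⟨ length-concatMap (children n) (λ _ → refl) (Qbar n Λ) ⟩
  3 * length (Qbar n Λ)
    ∎
  where
  open ≡-Reasoning
  1≤n : 1 ≤ n
  1≤n = ≤-trans (s≤s z≤n) 2≤n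
  children-all-unique : Unique (concatMap (children n) (Qbar n Λ))
  children-all-unique =
    Unique-concatMap (children n) (Qbar-unique n) (All.tabulate (Equivalence.to ∈-Qbar⇔))
      (children-unique 1≤n) (λ q q′ w≢w′ (π∈ , π∈′) → w≢w′ (sameParent 1≤n q q′ π∈ π∈′))

theorem4p3 : (n : ℕ) → 2 ≤ n →
    qbar n ((1 ∷ 3 ∷ 2 ∷ []) ∷ (3 ∷ 1 ∷ 2 ∷ []) ∷ []) ≡ 4 * 3 ^ (n ∸ 2)
theorem4p3 (suc zero)          (s≤s ())
theorem4p3 (suc (suc zero))    _ = refl
theorem4p3 (suc (suc (suc k))) _ = begin
  qbar (3 + k) Λ      ≡⟨ qbar-suc {2 + k} (s≤s (s≤s z≤n)) ⟩
  3 * qbar (2 + k) Λ  ≡⟨ cong (3 *_) (theorem4p3 (suc (suc k)) (s≤s (s≤s z≤n))) ⟩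
  3 * (4 * 3 ^ k)     ≡⟨ x∙yz≈y∙xz 3 4 (3 ^ k) ⟩
  4 * 3 ^ suc k       ∎
  where open ≡-Reasoning
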